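{- If $H$ is a source-sink-split of a digraph $D$, then $\operatorname{bw}(u(H))=\operatorname{dbw}(D)$.
   Context: All digraphs are finite; $u(H)$ is the underlying undirected graph of $H$. A source is a vertex of in-degree $0$ and a sink a vertex of out-degree $0$. Two vertices are source/sink-identifiable if both are sources or both are sinks. Identifying $x$ and $y$ replaces them by a single new vertex whose in-neighbourhood and out-neighbourhood are the unions of those of $x$ and $y$. A digraph $H'$ is equivalent to $D'$ under source-sink identification if $H'$ can be obtained from $D'$ by a sequence of identifications of pairs of source/sink-identifiable vertices. A digraph $H$ is a source-sink-split of $D$ if every source and every sink of $H$ has degree exactly $1$ and $D$ is equivalent to $H$ under source-sink identification. Branch-width: a branch decomposition of an undirected graph $G$ is a pair $(T,\tau)$ with $T$ a tree of maximum degree at most three and $\tau$ a bijection from the leaves of $T$ to $E(G)$. The order of an edge $e$ of $T$ is the number of vertices $v$ of $G$ for which there are leaves $t_1,t_2$ in different components of $T-e$ with $\tau(t_1),\tau(t_2)$ both incident with $v$. The width is the maximum order of an edge, and $\operatorname{bw}(G)$ is the minimum width. Directed branch-width: for $B\subseteq E(D)$ let $S_B^V=\{y\in V(D): \exists x,z \text{ with } \vec{xy}\in E(D)\setminus B,\ \vec{yz}\in B\}$ and $f_D(X)=|S_X^V\cup S_{E(D)\setminus X}^V|$. A directed branch decomposition is a pair $(T,\beta)$ with $T$ a tree of maximum degree at most three and $\beta$ a bijection from the leaves of $T$ to $E(D)$. For an edge $xy$ of $T$, with $Y$ the set of leaves in the component of $T-xy$ containing $y$, its order is $f_D(\beta(Y))$.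 The width is the maximum order of an edge, and $\operatorname{dbw}(D)$ is the minimum width. -}

module Defs where

open import Data.Nat using (ℕ; zero; suc; _+_; _≤_)
open import Data.Fin using (Fin; _≟_)
open import Data.Fin.Subset using (Subset; _∈_; ∣_∣)
open import Data.Bool using (Bool; true; false)
open import Data.Vec using (tabulate; countᵇ)
open import Data.List using (List; []; _∷_; _++_; [_]; length)
open import Data.List.Relation.Unary.Unique.Propositional using (Unique)
open import Data.List.Relation.Unary.Linked using (Linked)
open import Data.Product using (Σ; ∃; _×_; _,_; proj₁; proj₂)
open import Data.Sum using (_⊎_)
open import Relation.Nullary using (¬_; ⌊_⌋)
open import Relation.Binary.PropositionalEquality using (_≡_; _≢_)
open import Relation.Binary.Construct.Closure.ReflexiveTransitive using (Star)
open import Function.Bundles using (_↔_; _⇔_; Inverse)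
open import Function.Definitions using (Bijective; Surjective)

-- Cardinality of a (not necessarily decidable) set of vertices of Fin n:
-- P HasSize k  iff  the set {v | P v} is a subset of Fin n with k elements.

_HasSize_ : ∀ {n} → (Fin n → Set) → ℕ → Set
_HasSize_ {n} P k = Σ (Subset n) λ S → (∀ v → (v ∈ S) ⇔ P v) × ∣ S ∣ ≡ k

-- Finite digraphs (multiple edges and loops allowed).
-- Vertices Fin n, edges Fin m, each edge e goes from tail e to head e.

record Digraph : Set where
  field
    n    : ℕ
    m    : ℕ
    tail : Fin m → Fin n
    head : Fin m → Fin n
open Digraph public

indeg : (D : Digraph) → Fin (n D) → ℕ
indeg D v = countᵇ (λ e → ⌊ head D e ≟ v ⌋) (tabulate (λ e → e))

outdeg : (D : Digraph) → Fin (n D) → ℕ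
outdeg D v = countᵇ (λ e → ⌊ tail D e ≟ v ⌋) (tabulate (λ e → e))

degree : (D : Digraph) → Fin (n D) → ℕ
degree D v = indeg D v + outdeg D v

IsSource : (D : Digraph) → Fin (n D) → Set
IsSource D v = indeg D v ≡ 0

IsSink : (D : Digraph) → Fin (n D) → Set
IsSink D v = outdeg D v ≡ 0

SourceSinkIdentifiable : (D : Digraph) → Fin (n D) → Fin (n D) → Set
SourceSinkIdentifiable D x y =
  (IsSource D x × IsSource D y) ⊎ (IsSink D x × IsSink D y)

record Iso (D D' : Digraph) : Set where
  field
    vmap  : Fin (n D) ↔ Fin (n D')
    emap  : Fin (m D) ↔ Fin (m D')
    tail-pres : ∀ e → tail D' (Inverse.to emap e) ≡ Inverse.to vmap (tail D e)
    head-pres : ∀ e → head D' (Inverse.to emap e) ≡ Inverse.to vmap (head D e)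

-- D' is (isomorphic to) the digraph obtained from D by identifying the two
-- distinct source/sink-identifiable vertices x and y: the vertex map φ merges
-- exactly x and y and is otherwise a bijection, every edge is kept (edge
-- bijection ψ), and edges are redirected along φ.  Thus the new vertex has as
-- in-/out-edges the union of those of x and y.
record IdentStep (D D' : Digraph) : Set where
  field
    x y   : Fin (n D)
    x≢y   : x ≢ y
    ident : SourceSinkIdentifiable D x y
    φ     : Fin (n D) → Fin (n D')
    φ-surj : Surjective _≡_ _≡_ φ
    φ-fibres : ∀ a b → (φ a ≡ φ b) ⇔ (a ≡ b ⊎ ((a ≡ x × b ≡ y) ⊎ (a ≡ y × b ≡ x)))
    ψ     : Fin (m D) ↔ Fin (m D')
    tail-pres : ∀ e → tail D' (Inverse.to ψ e) ≡ φ (tail D e)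
    head-pres : ∀ e → head D' (Inverse.to ψ e) ≡ φ (head D e)

data ObtainedBySSI (H : Digraph) : Digraph → Set where
  done : ∀ {D} → Iso H D → ObtainedBySSI H D
  step : ∀ {H' D} → IdentStep H H' → ObtainedBySSI H' D → ObtainedBySSI H D

IsSourceSinkSplit : Digraph → Digraph → Set
IsSourceSinkSplit H D =
  (∀ v → IsSource H v → degree H v ≡ 1) ×
  (∀ v → IsSink H v → degree H v ≡ 1) ×
  ObtainedBySSI H D

-- Finite undirected multigraphs (loops allowed): edge e has ends end₁ e, end₂ e.

record Graph : Set where
  field
    gn   : ℕ
    gm   : ℕ
    end₁ : Fin gm → Fin gn
    end₂ : Fin gm → Fin gn
open Graph public

Incident : (G : Graph) → Fin (gm G) → Fin (gn G) → Set
Incident G e v = end₁ G e ≡ v ⊎ end₂ G e ≡ v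

u : Digraph → Graph
u D = record { gn = n D ; gm = m D ; end₁ = tail D ; end₂ = head D }

module _ {t : ℕ} (adj : Fin t → Fin t → Bool) where
  Adjᵇ : Fin t → Fin t → Set
  Adjᵇ a b = adj a b ≡ true

  degᵇ : Fin t → ℕ
  degᵇ a = countᵇ (adj a) (tabulate (λ b → b))

  IsCycleᵇ : List (Fin t) → Set
  IsCycleᵇ [] = ¬ (0 ≡ 0)
  IsCycleᵇ (v ∷ rest) = 2 ≤ length rest × Unique (v ∷ rest) × Linked Adjᵇ (v ∷ rest ++ [ v ])

record SubcubicTree : Set where
  field
    t      : ℕ
    adj    : Fin t → Fin t → Bool
    adj-sym   : ∀ a b → adj a b ≡ adj b a
    adj-irrefl : ∀ a → adj a a ≡ false
    connected : ∀ a b → Star (Adjᵇ adj) a b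
    acyclic   : ∀ cs → ¬ IsCycleᵇ adj cs
    maxdeg≤3  : ∀ a → degᵇ adj a ≤ 3
  Adj : Fin t → Fin t → Set
  Adj = Adjᵇ adj
  deg : Fin t → ℕ
  deg = degᵇ adj
  Leaf : Set
  Leaf = Σ (Fin t) λ a → deg a ≤ 1
  AdjMinus : Fin t → Fin t → Fin t → Fin t → Set
  AdjMinus x y a b = Adj a b × ¬ ((a ≡ x × b ≡ y) ⊎ (a ≡ y × b ≡ x))
  ConnMinus : Fin t → Fin t → Fin t → Fin t → Set
  ConnMinus x y a b = Star (AdjMinus x y) a b
open SubcubicTree public

record BranchDecomposition (G : Graph) : Set where
  field
    T   : SubcubicTree
    τ   : Leaf T → Fin (gm G)
    τ-bij : Bijective _≡_ _≡_ τ
open BranchDecomposition public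

-- vertices v counted in the order of the tree edge xy
OrderSet : (G : Graph) → (B : BranchDecomposition G) → Fin (t (T B)) → Fin (t (T B)) → Fin (gn G) → Set
OrderSet G B x y v =
  Σ (Leaf (T B)) λ l₁ → Σ (Leaf (T B)) λ l₂ →
    ¬ ConnMinus (T B) x y (proj₁ l₁) (proj₁ l₂) ×
    Incident G (τ B l₁) v × Incident G (τ B l₂) v

HasWidthAtMost : (G : Graph) → BranchDecomposition G → ℕ → Set
HasWidthAtMost G B k =
  ∀ x y → Adj (T B) x y → Σ ℕ λ j → j ≤ k × (OrderSet G B x y HasSize j)

IsBranchWidth : Graph → ℕ → Set
IsBranchWidth G k =
  Σ (BranchDecomposition G) (λ B → HasWidthAtMost G B k) ×
  (∀ (B : BranchDecomposition G) j → HasWidthAtMost G B j → k ≤ j)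

SV : (D : Digraph) → (Fin (m D) → Set) → Fin (n D) → Set
SV D B w = (∃ λ e → ¬ B e × head D e ≡ w) × (∃ λ e → B e × tail D e ≡ w)

-- the vertex set whose size is f_D(X)
FSet : (D : Digraph) → (Fin (m D) → Set) → Fin (n D) → Set
FSet D X w = SV D X w ⊎ SV D (λ e → ¬ X e) w

record DirBranchDecomposition (D : Digraph) : Set where
  field
    T   : SubcubicTree
    β   : Leaf T → Fin (m D)
    β-bij : Bijective _≡_ _≡_ β
open DirBranchDecomposition public

-- β(Y) where Y = leaves in the component of T - xy containing y
βY : (D : Digraph) → (B : DirBranchDecomposition D) → Fin (t (T B)) → Fin (t (T B)) → Fin (m D) → Set
βY D B x y e = Σ (Leaf (T B)) λ l → ConnMinus (T B) x y y (proj₁ l) × β B l ≡ e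

DirHasWidthAtMost : (D : Digraph) → DirBranchDecomposition D → ℕ → Set
DirHasWidthAtMost D B k =
  ∀ x y → Adj (T B) x y → Σ ℕ λ j → j ≤ k × (FSet D (βY D B x y) HasSize j)

IsDirBranchWidth : Digraph → ℕ → Set
IsDirBranchWidth D k =
  Σ (DirBranchDecomposition D) (λ B → DirHasWidthAtMost D B k) ×
  (∀ (B : DirBranchDecomposition D) j → DirHasWidthAtMost D B j → k ≤ j)

{-# OPTIONS --safe #-}
-- Identifying sources with sources and sinks with sinks keeps every edge and never merges a
-- vertex having an in-edge with a different vertex having an out-edge.  Hence branch
-- decompositions of u(H) and directed branch decompositions of D are the same trees with
-- corresponding leaf labels, and it suffices to compare, for one tree edge xy, the vertices
-- counted by bw and by dbw.  A vertex v of H counted by bw is incident with two edges on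
-- different sides of xy; as sources and sinks of H have degree 1, v has an in-edge and an
-- out-edge, and then some in-edge and some out-edge of v lie on different sides.  These are
-- exactly the vertices whose images are counted by f_D, and v ↦ its image is injective on
-- vertices with both an in-edge and an out-edge, so both orders agree.
module Submission where

open import Defs
open import Data.Bool using (Bool; true; false)
open import Data.Bool.Properties using (T-≡; T-not-≡)
open import Data.Empty using (⊥; ⊥-elim)
open import Data.Fin using (Fin; zero; suc; _≟_)
open import Data.Fin.Properties using (any?; suc-injective; ¬Fin0; 0≢1+n)
open import Data.Fin.Subset using (Subset; _∈_; _∉_; ∣_∣; _-_; inside; outside)
open import Data.Fin.Subset.Properties using (_∈?_; x∈p∧x≢y⇒x∈p-y; p─q⊆p; p─⊥≡p; Empty-unique; ∣⊥∣≡0)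
open import Data.Nat using (ℕ; zero; suc; _≤_; z≤n; s≤s)
open import Data.Nat.Properties using (≤-trans; m≤m+n; m≤n+m; +-mono-≤; 1+n≰n)
open import Data.Product using (Σ; ∃; ∃₂; _×_; _,_; proj₁; proj₂)
import Data.Product as Product
open import Data.Sum using (_⊎_; inj₁; inj₂; [_,_])
import Data.Sum as Sum
open import Data.Vec using ([]; _∷_; tabulate; countᵇ; here; there)
open import Data.Vec.Properties using ([]=⇒lookup; lookup⇒[]=; lookup∘tabulate)
open import Function using (_∘_)
open import Function.Bundles using (_⇔_; mk⇔; Equivalence; Inverse; _↔_; Bijection)
open import Function.Consequences.Propositional using (surjective⇒strictlySurjective)
open import Function.Construct.Composition using (bijective)
open import Function.Definitions using (Bijective)
open import Function.Properties.Inverse using (↔-trans; ↔-sym; ↔⇒⤖)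
open import Relation.Binary.PropositionalEquality using (_≡_; _≢_; refl; sym; trans; cong; subst)
open import Relation.Binary.Construct.Closure.ReflexiveTransitive using (Star; ε; _◅_; _◅◅_; reverse)
open import Relation.Nullary using (¬_; yes; no; ⌊_⌋)
open import Relation.Nullary.Decidable using (toWitness; fromWitness; fromWitnessFalse; decidable-stable; _×-dec_)
open import Relation.Unary using (Decidable)

open Equivalence using (to; from)

module _ {n : ℕ} where

  ∈-tabulate : (g : Fin n → Bool) (v : Fin n) → v ∈ tabulate g ⇔ g v ≡ true
  ∈-tabulate g v = mk⇔ (λ v∈ → trans (sym (lookup∘tabulate g v)) ([]=⇒lookup v∈))
                       (λ gv → lookup⇒[]= v (tabulate g) (trans (lookup∘tabulate g v) gv))

  subsetOf : {P : Fin n → Set} → Decidable P → Subset n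
  subsetOf P? = tabulate (⌊_⌋ ∘ P?)

  ∈-subsetOf : {P : Fin n → Set} (P? : Decidable P) (v : Fin n) → v ∈ subsetOf P? ⇔ P v
  ∈-subsetOf P? v = mk⇔ (λ v∈ → toWitness (from T-≡ (to (∈-tabulate _ v) v∈)))
                        (λ p → from (∈-tabulate _ v) (to T-≡ (fromWitness p)))

x∈p⇒∣p∣≡1+∣p-x∣ : ∀ {n} {x : Fin n} {p : Subset n} → x ∈ p → ∣ p ∣ ≡ suc ∣ p - x ∣
x∈p⇒∣p∣≡1+∣p-x∣ {x = zero}  {inside  ∷ p} here        = cong (suc ∘ ∣_∣) (sym (p─⊥≡p p))
x∈p⇒∣p∣≡1+∣p-x∣ {x = suc x} {inside  ∷ p} (there x∈p) = cong suc (x∈p⇒∣p∣≡1+∣p-x∣ x∈p)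
x∈p⇒∣p∣≡1+∣p-x∣ {x = suc x} {outside ∷ p} (there x∈p) = x∈p⇒∣p∣≡1+∣p-x∣ x∈p

x∉p-x : ∀ {n} {x : Fin n} (p : Subset n) → x ∉ p - x
x∉p-x {x = zero}  (_ ∷ p) ()
x∉p-x {x = suc x} (_ ∷ p) (there x∈) = x∉p-x p x∈

∣p∣≡∣q∣-by-bijection : ∀ {a b} {p : Subset a} {q : Subset b} (f : Fin a → Fin b) →
  (∀ {v} → v ∈ p → f v ∈ q) →
  (∀ {v v'} → v ∈ p → v' ∈ p → f v ≡ f v' → v ≡ v') →
  (∀ {w} → w ∈ q → ∃ λ v → v ∈ p × f v ≡ w) →
  ∣ p ∣ ≡ ∣ q ∣
∣p∣≡∣q∣-by-bijection {b = b} {p = []} {q} f _ _ onto =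
  sym (trans (cong ∣_∣ (Empty-unique λ (w , w∈q) → ¬Fin0 (proj₁ (onto w∈q)))) (∣⊥∣≡0 b))
∣p∣≡∣q∣-by-bijection {p = outside ∷ p} {q} f into inj onto =
  ∣p∣≡∣q∣-by-bijection (f ∘ suc) (into ∘ there)
    (λ v∈ v'∈ → suc-injective ∘ inj (there v∈) (there v'∈)) onto-suc
  where
  onto-suc : ∀ {w} → w ∈ q → ∃ λ v → v ∈ p × f (suc v) ≡ w
  onto-suc w∈ with onto w∈
  ... | suc v , there v∈ , fv≡w = v , v∈ , fv≡w
∣p∣≡∣q∣-by-bijection {p = inside ∷ p} {q} f into inj onto =
  trans (cong suc (∣p∣≡∣q∣-by-bijection (f ∘ suc) into-rest
                    (λ v∈ v'∈ → suc-injective ∘ inj (there v∈) (there v'∈)) onto-rest))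
        (sym (x∈p⇒∣p∣≡1+∣p-x∣ (into here)))
  where
  into-rest : ∀ {v} → v ∈ p → f (suc v) ∈ q - f zero
  into-rest v∈ = x∈p∧x≢y⇒x∈p-y (into (there v∈)) (λ eq → 0≢1+n (inj here (there v∈) (sym eq)))
  onto-rest : ∀ {w} → w ∈ q - f zero → ∃ λ v → v ∈ p × f (suc v) ≡ w
  onto-rest w∈ with onto (p─q⊆p q _ w∈)
  ... | zero  , _ , refl        = ⊥-elim (x∉p-x q w∈)
  ... | suc v , there v∈ , fv≡w = v , v∈ , fv≡w

-- P need not be decidable; the decidable R, on which f is injective, lets us cut P out of
-- the preimage of a subset representing Q.
module _ {a b} {P R : Fin a → Set} {Q : Fin b → Set} (R? : Decidable R) (f : Fin a → Fin b)
         (f-injective : ∀ {v v'} → R v → R v' → f v ≡ f v' → v ≡ v')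
         (P⇔R×Q∘f : ∀ v → P v ⇔ (R v × Q (f v)))
         (Q⊆f[R] : ∀ {w} → Q w → ∃ λ v → R v × f v ≡ w) where

  private
    Q⊆f[P] : ∀ {w} → Q w → ∃ λ v → P v × f v ≡ w
    Q⊆f[P] q with Q⊆f[R] q
    ... | v , r , refl = v , from (P⇔R×Q∘f v) (r , q) , refl

    ∣S∣≡∣S'∣ : ∀ {S S'} → (∀ v → v ∈ S ⇔ P v) → (∀ w → w ∈ S' ⇔ Q w) → ∣ S ∣ ≡ ∣ S' ∣
    ∣S∣≡∣S'∣ S⇔P S'⇔Q = ∣p∣≡∣q∣-by-bijection f
      (λ v∈ → from (S'⇔Q _) (proj₂ (to (P⇔R×Q∘f _) (to (S⇔P _) v∈))))
      (λ v∈ v'∈ → f-injective (proj₁ (to (P⇔R×Q∘f _) (to (S⇔P _) v∈)))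
                              (proj₁ (to (P⇔R×Q∘f _) (to (S⇔P _) v'∈))))
      (λ w∈ → let (v , pv , fv≡w) = Q⊆f[P] (to (S'⇔Q _) w∈) in v , from (S⇔P v) pv , fv≡w)

  hasSize-transfer : ∀ j → P HasSize j ⇔ Q HasSize j
  hasSize-transfer j = mk⇔ forward backward
    where
    forward : P HasSize j → Q HasSize j
    forward (S , S⇔P , ∣S∣≡j) = image , image⇔Q , trans (sym (∣S∣≡∣S'∣ S⇔P image⇔Q)) ∣S∣≡j
      where
      inImage? : Decidable (λ w → ∃ λ v → v ∈ S × f v ≡ w)
      inImage? w = any? λ v → (v ∈? S) ×-dec (f v ≟ w)
      image : Subset b
      image = subsetOf inImage?
      image⇔Q : ∀ w → w ∈ image ⇔ Q w
      image⇔Q w = mk⇔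
        (λ w∈ → let (v , v∈ , fv≡w) = to (∈-subsetOf inImage? w) w∈ in
                subst Q fv≡w (proj₂ (to (P⇔R×Q∘f v) (to (S⇔P v) v∈))))
        (λ q → let (v , pv , fv≡w) = Q⊆f[P] q in
               from (∈-subsetOf inImage? w) (v , from (S⇔P v) pv , fv≡w))
    backward : Q HasSize j → P HasSize j
    backward (S' , S'⇔Q , ∣S'∣≡j) =
      preimage , preimage⇔P , trans (∣S∣≡∣S'∣ preimage⇔P S'⇔Q) ∣S'∣≡j
      where
      pulled? : Decidable (λ v → R v × f v ∈ S')
      pulled? v = R? v ×-dec (f v ∈? S')
      preimage : Subset a
      preimage = subsetOf pulled?
      preimage⇔P : ∀ v → v ∈ preimage ⇔ P v
      preimage⇔P v = mk⇔
        (λ v∈ → let (r , fv∈) = to (∈-subsetOf pulled? v) v∈ in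
                from (P⇔R×Q∘f v) (r , to (S'⇔Q _) fv∈))
        (λ p → let (r , q) = to (P⇔R×Q∘f v) p in
               from (∈-subsetOf pulled? v) (r , from (S'⇔Q _) q))

module _ {A : Set} (p : A → Bool) where

  countᵇ≡0 : ∀ {m} (g : Fin m → A) → (∀ i → p (g i) ≡ false) → countᵇ p (tabulate g) ≡ 0
  countᵇ≡0 {zero}  g none = refl
  countᵇ≡0 {suc m} g none with p (g zero) | none zero
  ... | false | _ = countᵇ≡0 (g ∘ suc) (none ∘ suc)

  1≤countᵇ : ∀ {m} (g : Fin m → A) i → p (g i) ≡ true → 1 ≤ countᵇ p (tabulate g)
  1≤countᵇ g zero    pgi with p (g zero)
  ... | true = s≤s z≤n
  1≤countᵇ g (suc i) pgi with p (g zero)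
  ... | true  = s≤s z≤n
  ... | false = 1≤countᵇ (g ∘ suc) i pgi

  2≤countᵇ : ∀ {m} (g : Fin m → A) {i j} → i ≢ j → p (g i) ≡ true → p (g j) ≡ true →
             2 ≤ countᵇ p (tabulate g)
  2≤countᵇ g {zero}  {zero}  i≢j _   _   = ⊥-elim (i≢j refl)
  2≤countᵇ g {zero}  {suc j} _   pgi pgj with p (g zero)
  ... | true = s≤s (1≤countᵇ (g ∘ suc) j pgj)
  2≤countᵇ g {suc i} {zero}  _   pgi pgj with p (g zero)
  ... | true = s≤s (1≤countᵇ (g ∘ suc) i pgi)
  2≤countᵇ g {suc i} {suc j} i≢j pgi pgj with p (g zero)
  ... | true  = s≤s (1≤countᵇ (g ∘ suc) i pgi)
  ... | false = 2≤countᵇ (g ∘ suc) (i≢j ∘ cong suc) pgi pgj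

-- indeg D v and outdeg D v are, definitionally, fibreSize (head D) v and fibreSize (tail D) v.
module _ {m n : ℕ} (f : Fin m → Fin n) (v : Fin n) where

  fibreSize : ℕ
  fibreSize = countᵇ (λ e → ⌊ f e ≟ v ⌋) (tabulate (λ e → e))

  private
    hit : ∀ {e} → f e ≡ v → ⌊ f e ≟ v ⌋ ≡ true
    hit = to T-≡ ∘ fromWitness

    miss : ∀ {e} → f e ≢ v → ⌊ f e ≟ v ⌋ ≡ false
    miss = to T-not-≡ ∘ fromWitnessFalse

  1≤fibreSize : ∀ {e} → f e ≡ v → 1 ≤ fibreSize
  1≤fibreSize {e} fe≡v = 1≤countᵇ _ _ e (hit fe≡v)

  2≤fibreSize : ∀ {e e'} → e ≢ e' → f e ≡ v → f e' ≡ v → 2 ≤ fibreSize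
  2≤fibreSize e≢e' fe≡v fe'≡v = 2≤countᵇ _ _ e≢e' (hit fe≡v) (hit fe'≡v)

  fibreSize≡0⇔∉image : fibreSize ≡ 0 ⇔ (¬ ∃ λ e → f e ≡ v)
  fibreSize≡0⇔∉image = mk⇔
    (λ size≡0 (e , fe≡v) → 1+n≰n (subst (1 ≤_) size≡0 (1≤fibreSize fe≡v)))
    (λ ∉image → countᵇ≡0 _ _ λ e → miss (λ fe≡v → ∉image (e , fe≡v)))

HasInEdge HasOutEdge IsInner : (D : Digraph) → Fin (n D) → Set
HasInEdge D v = ∃ λ e → head D e ≡ v
HasOutEdge D v = ∃ λ e → tail D e ≡ v
IsInner D v = HasInEdge D v × HasOutEdge D v

isInner? : (D : Digraph) → Decidable (IsInner D)
isInner? D v = any? (λ e → head D e ≟ v) ×-dec any? (λ e → tail D e ≟ v)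

TerminalsHaveDegreeOne : Digraph → Set
TerminalsHaveDegreeOne H =
  (∀ v → IsSource H v → degree H v ≡ 1) × (∀ v → IsSink H v → degree H v ≡ 1)

module _ (H : Digraph) {e e' : Fin (m H)} {v : Fin (n H)} where

  2≤degree : e ≢ e' → Incident (u H) e v → Incident (u H) e' v → 2 ≤ degree H v
  2≤degree e≢e' (inj₁ t) (inj₁ t') = ≤-trans (2≤fibreSize (tail H) v e≢e' t t') (m≤n+m _ _)
  2≤degree e≢e' (inj₂ h) (inj₂ h') = ≤-trans (2≤fibreSize (head H) v e≢e' h h') (m≤m+n _ _)
  2≤degree _ (inj₁ t) (inj₂ h') = +-mono-≤ (1≤fibreSize (head H) v h') (1≤fibreSize (tail H) v t)
  2≤degree _ (inj₂ h) (inj₁ t') = +-mono-≤ (1≤fibreSize (head H) v h) (1≤fibreSize (tail H) v t')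

  twoIncident⇒isInner : TerminalsHaveDegreeOne H → e ≢ e' →
                        Incident (u H) e v → Incident (u H) e' v → IsInner H v
  twoIncident⇒isInner (sources , sinks) e≢e' e∋v e'∋v =
    decidable-stable (any? λ e → head H e ≟ v)
      (λ ∉in → degree≢1 (sources v (from (fibreSize≡0⇔∉image (head H) v) ∉in))) ,
    decidable-stable (any? λ e → tail H e ≟ v)
      (λ ∉out → degree≢1 (sinks v (from (fibreSize≡0⇔∉image (tail H) v) ∉out)))
    where
    degree≢1 : degree H v ≢ 1
    degree≢1 deg≡1 = 1+n≰n (subst (2 ≤_) deg≡1 (2≤degree e≢e' e∋v e'∋v))

identifiable-sym : ∀ D {a b} → SourceSinkIdentifiable D a b → SourceSinkIdentifiable D b a
identifiable-sym D = Sum.map Product.swap Product.swap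

identifiable⇒¬in×out : ∀ D {a b} → SourceSinkIdentifiable D a b →
                       HasInEdge D a → HasOutEdge D b → ⊥
identifiable⇒¬in×out D {a} (inj₁ (a-source , _)) a-in _ =
  to (fibreSize≡0⇔∉image (head D) a) a-source a-in
identifiable⇒¬in×out D {b = b} (inj₂ (_ , b-sink)) _ b-out =
  to (fibreSize≡0⇔∉image (tail D) b) b-sink b-out

record SourceSinkMerge (H D : Digraph) : Set where
  field
    vmap : Fin (n H) → Fin (n D)
    emap : Fin (m H) ↔ Fin (m D)
    tail-pres : ∀ e → tail D (Inverse.to emap e) ≡ vmap (tail H e)
    head-pres : ∀ e → head D (Inverse.to emap e) ≡ vmap (head H e)
    in-out-injective : ∀ {a b} → vmap a ≡ vmap b → HasInEdge H a → HasOutEdge H b → a ≡ b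

iso⇒merge : ∀ {H D} → Iso H D → SourceSinkMerge H D
iso⇒merge I = record
  { vmap = Inverse.to vmap
  ; emap = emap
  ; tail-pres = tail-pres
  ; head-pres = head-pres
  ; in-out-injective = λ eq _ _ → Bijection.injective (↔⇒⤖ vmap) eq
  }
  where open Iso I

identStep⇒merge : ∀ {H H' D} → IdentStep H H' → SourceSinkMerge H' D → SourceSinkMerge H D
identStep⇒merge {H} st σ = record
  { vmap = σ.vmap ∘ φ
  ; emap = ↔-trans ψ σ.emap
  ; tail-pres = λ e → trans (σ.tail-pres (Inverse.to ψ e)) (cong σ.vmap (tail-pres e))
  ; head-pres = λ e → trans (σ.head-pres (Inverse.to ψ e)) (cong σ.vmap (head-pres e))
  ; in-out-injective = in-out-injective
  }
  where
  open IdentStep st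
  module σ = SourceSinkMerge σ
  in-out-injective : ∀ {a b} → σ.vmap (φ a) ≡ σ.vmap (φ b) → HasInEdge H a → HasOutEdge H b → a ≡ b
  in-out-injective {a} {b} eq a-in@(ea , ea→a) b-out@(eb , b→eb)
    with to (φ-fibres a b) (σ.in-out-injective eq
           (Inverse.to ψ ea , trans (head-pres ea) (cong φ ea→a))
           (Inverse.to ψ eb , trans (tail-pres eb) (cong φ b→eb)))
  ... | inj₁ a≡b = a≡b
  ... | inj₂ (inj₁ (refl , refl)) = ⊥-elim (identifiable⇒¬in×out H ident a-in b-out)
  ... | inj₂ (inj₂ (refl , refl)) =
    ⊥-elim (identifiable⇒¬in×out H (identifiable-sym H ident) a-in b-out)

obtainedBySSI⇒merge : ∀ {H D} → ObtainedBySSI H D → SourceSinkMerge H D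
obtainedBySSI⇒merge (done iso)     = iso⇒merge iso
obtainedBySSI⇒merge (step st rest) = identStep⇒merge st (obtainedBySSI⇒merge rest)

module Cut (T : SubcubicTree) (x y : Fin (t T)) where

  infix 4 _~_
  _~_ : Fin (t T) → Fin (t T) → Set
  _~_ = ConnMinus T x y

  ~-sym : ∀ {a b} → a ~ b → b ~ a
  ~-sym = reverse λ (a-b , ¬xy) →
    trans (adj-sym T _ _) a-b , ¬xy ∘ Sum.swap ∘ Sum.map Product.swap Product.swap

  joined-to-x-or-y : ∀ a → a ~ x ⊎ a ~ y
  joined-to-x-or-y a = go (connected T a y)
    where
    go : ∀ {a} → Star (Adj T) a y → a ~ x ⊎ a ~ y
    go ε = inj₂ ε
    go {a} (_◅_ {j = b} a-b path) with a ≟ x | a ≟ y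
    ... | yes refl | _        = inj₁ ε
    ... | no _     | yes refl = inj₂ ε
    ... | no a≢x   | no a≢y   = Sum.map (edge ◅_) (edge ◅_) (go path)
      where
      edge : AdjMinus T x y a b
      edge = a-b , [ a≢x ∘ proj₁ , a≢y ∘ proj₁ ]

  separated⇒joined-to-one : ∀ {a b} → ¬ a ~ b → ∀ c → a ~ c ⊎ c ~ b
  separated⇒joined-to-one {a} {b} a≁b c
    with joined-to-x-or-y a | joined-to-x-or-y b | joined-to-x-or-y c
  ... | inj₁ a~x | inj₁ b~x | _        = ⊥-elim (a≁b (a~x ◅◅ ~-sym b~x))
  ... | inj₂ a~y | inj₂ b~y | _        = ⊥-elim (a≁b (a~y ◅◅ ~-sym b~y))
  ... | inj₁ a~x | inj₂ _   | inj₁ c~x = inj₁ (a~x ◅◅ ~-sym c~x)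
  ... | inj₁ _   | inj₂ b~y | inj₂ c~y = inj₂ (c~y ◅◅ ~-sym b~y)
  ... | inj₂ a~y | inj₁ _   | inj₂ c~y = inj₁ (a~y ◅◅ ~-sym c~y)
  ... | inj₂ _   | inj₁ b~x | inj₁ c~x = inj₂ (c~x ◅◅ ~-sym b~x)

module OrderCorrespondence
  {H D : Digraph} (σ : SourceSinkMerge H D) (terminals : TerminalsHaveDegreeOne H)
  (T : SubcubicTree) {τ : Leaf T → Fin (m H)} (τ-bij : Bijective _≡_ _≡_ τ)
  {β : Leaf T → Fin (m D)} (β-bij : Bijective _≡_ _≡_ β)
  (β≗emap∘τ : ∀ l → β l ≡ Inverse.to (SourceSinkMerge.emap σ) (τ l))
  (x y : Fin (t T)) where

  open SourceSinkMerge σ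
  open Cut T x y

  private
    τ-preimage : ∀ e → ∃ λ l → τ l ≡ e
    τ-preimage = surjective⇒strictlySurjective (proj₂ τ-bij)

    β-preimage : ∀ e → ∃ λ l → β l ≡ e
    β-preimage = surjective⇒strictlySurjective (proj₂ β-bij)

  BU : BranchDecomposition (u H)
  BU = record { T = T ; τ = τ ; τ-bij = τ-bij }

  BD : DirBranchDecomposition D
  BD = record { T = T ; β = β ; β-bij = β-bij }

  InOrderSet : Fin (n H) → Set
  InOrderSet = OrderSet (u H) BU x y

  X : Fin (m D) → Set
  X = βY D BD x y

  Separated : Leaf T → Leaf T → Set
  Separated a b = ¬ proj₁ a ~ proj₁ b

  Crossing : Fin (n H) → Set
  Crossing v = ∃₂ λ a b → head H (τ a) ≡ v × tail H (τ b) ≡ v × Separated a b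

  crossing⇒orderSet : ∀ {v} → Crossing v → InOrderSet v
  crossing⇒orderSet (a , b , a→v , v→b , a≁b) = a , b , a≁b , inj₂ a→v , inj₁ v→b

  crossing⇒isInner : ∀ {v} → Crossing v → IsInner H v
  crossing⇒isInner (a , b , a→v , v→b , _) = (τ a , a→v) , (τ b , v→b)

  orderSet⇒isInner : ∀ {v} → InOrderSet v → IsInner H v
  orderSet⇒isInner (a , b , a≁b , a∋v , b∋v) =
    twoIncident⇒isInner H terminals τa≢τb a∋v b∋v
    where
    τa≢τb : τ a ≢ τ b
    τa≢τb τa≡τb = a≁b (subst (λ l → proj₁ a ~ proj₁ l) (proj₁ τ-bij τa≡τb) ε)

  inLeaf : ∀ {v} → HasInEdge H v → ∃ λ l → head H (τ l) ≡ v
  inLeaf (e , e→v) with τ-preimage e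
  ... | l , refl = l , e→v

  outLeaf : ∀ {v} → HasOutEdge H v → ∃ λ l → tail H (τ l) ≡ v
  outLeaf (e , v→e) with τ-preimage e
  ... | l , refl = l , v→e

  orderSet⇒crossing : ∀ {v} → InOrderSet v → Crossing v
  orderSet⇒crossing {v} counted@(a , b , a≁b , a∋v , b∋v) = by-incidence a∋v b∋v
    where
    inner : IsInner H v
    inner = orderSet⇒isInner counted
    by-incidence : Incident (u H) (τ a) v → Incident (u H) (τ b) v → Crossing v
    by-incidence (inj₂ a→v) (inj₁ v→b) = a , b , a→v , v→b , a≁b
    by-incidence (inj₁ v→a) (inj₂ b→v) = b , a , b→v , v→a , a≁b ∘ ~-sym
    by-incidence (inj₂ a→v) (inj₂ b→v) with outLeaf (proj₂ inner)
    ... | o , v→o = [ (λ a~o → b , o , b→v , v→o , λ b~o → a≁b (a~o ◅◅ ~-sym b~o))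
                    , (λ o~b → a , o , a→v , v→o , λ a~o → a≁b (a~o ◅◅ o~b))
                    ] (separated⇒joined-to-one a≁b (proj₁ o))
    by-incidence (inj₁ v→a) (inj₁ v→b) with inLeaf (proj₁ inner)
    ... | i , i→v = [ (λ a~i → i , b , i→v , v→b , λ i~b → a≁b (a~i ◅◅ i~b))
                    , (λ i~b → i , a , i→v , v→a , λ i~a → a≁b (~-sym i~a ◅◅ i~b))
                    ] (separated⇒joined-to-one a≁b (proj₁ i))

  X∘β⇔onYSide : ∀ l → X (β l) ⇔ y ~ proj₁ l
  X∘β⇔onYSide l = mk⇔
    (λ (l' , y~l' , βl'≡βl) → subst (λ l → y ~ proj₁ l) (proj₁ β-bij βl'≡βl) y~l')
    (λ y~l → l , y~l , refl)

  head-β : ∀ {l v} → head H (τ l) ≡ v → head D (β l) ≡ vmap v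
  head-β {l} l→v = trans (cong (head D) (β≗emap∘τ l)) (trans (head-pres (τ l)) (cong vmap l→v))

  tail-β : ∀ {l v} → tail H (τ l) ≡ v → tail D (β l) ≡ vmap v
  tail-β {l} v→l = trans (cong (tail D) (β≗emap∘τ l)) (trans (tail-pres (τ l)) (cong vmap v→l))

  crossing⇒fSet : ∀ {v} → Crossing v → FSet D X (vmap v)
  crossing⇒fSet (a , b , a→v , v→b , a≁b) with separated⇒joined-to-one a≁b y
  ... | inj₁ a~y = inj₂ ( (β a , (λ ¬Xβa → ¬Xβa (from (X∘β⇔onYSide a) (~-sym a~y))) , head-β a→v)
                        , (β b , (λ Xβb → a≁b (a~y ◅◅ to (X∘β⇔onYSide b) Xβb)) , tail-β v→b))
  ... | inj₂ y~b = inj₁ ( (β a , (λ Xβa → a≁b (~-sym (to (X∘β⇔onYSide a) Xβa) ◅◅ y~b)) , head-β a→v)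
                        , (β b , from (X∘β⇔onYSide b) y~b , tail-β v→b))

  fSet⇒separatedLeaves : ∀ {w} → FSet D X w →
    ∃₂ λ a b → head D (β a) ≡ w × tail D (β b) ≡ w × Separated a b
  fSet⇒separatedLeaves (inj₁ ((e , ¬Xe , e→w) , (e' , Xe' , w→e')))
    with β-preimage e | β-preimage e'
  ... | a , refl | b , refl = a , b , e→w , w→e' ,
    λ a~b → ¬Xe (from (X∘β⇔onYSide a) (to (X∘β⇔onYSide b) Xe' ◅◅ ~-sym a~b))
  fSet⇒separatedLeaves (inj₂ ((e , ¬¬Xe , e→w) , (e' , ¬Xe' , w→e')))
    with β-preimage e | β-preimage e'
  ... | a , refl | b , refl = a , b , e→w , w→e' ,
    λ a~b → ¬¬Xe λ Xe → ¬Xe' (from (X∘β⇔onYSide b) (to (X∘β⇔onYSide a) Xe ◅◅ a~b))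

  fSet⇒crossing : ∀ {w} → FSet D X w → ∃ λ v → Crossing v × vmap v ≡ w
  fSet⇒crossing {w} fSet with fSet⇒separatedLeaves fSet
  ... | a , b , a→w , w→b , a≁b =
    head H (τ a) , (a , b , refl , sym merged , a≁b) , vmap-head
    where
    vmap-head : vmap (head H (τ a)) ≡ w
    vmap-head = trans (sym (head-β refl)) a→w
    merged : head H (τ a) ≡ tail H (τ b)
    merged = in-out-injective (trans vmap-head (trans (sym w→b) (tail-β refl)))
                              (τ a , refl) (τ b , refl)

  orderSet⇔isInner×fSet : ∀ v → InOrderSet v ⇔ (IsInner H v × FSet D X (vmap v))
  orderSet⇔isInner×fSet v = mk⇔
    (λ counted → orderSet⇒isInner counted , crossing⇒fSet (orderSet⇒crossing counted))
    (λ (inner , fSet) → let (v' , crossing , v'↦v) = fSet⇒crossing fSet in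
      crossing⇒orderSet (subst Crossing
        (in-out-injective v'↦v (proj₁ (crossing⇒isInner crossing)) (proj₂ inner)) crossing))

  orderSet-hasSize⇔fSet-hasSize : ∀ j → InOrderSet HasSize j ⇔ FSet D X HasSize j
  orderSet-hasSize⇔fSet-hasSize = hasSize-transfer (isInner? H) vmap
    (λ v-inner v'-inner v↦v' → in-out-injective v↦v' (proj₁ v-inner) (proj₂ v'-inner))
    orderSet⇔isInner×fSet
    (λ fSet → let (v , crossing , v↦w) = fSet⇒crossing fSet in v , crossing⇒isInner crossing , v↦w)

module _ {H D : Digraph} (σ : SourceSinkMerge H D) where

  open SourceSinkMerge σ
  open OrderCorrespondence σ using (orderSet-hasSize⇔fSet-hasSize)

  toDirected : BranchDecomposition (u H) → DirBranchDecomposition D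
  toDirected B = record
    { T = T B
    ; β = Inverse.to emap ∘ τ B
    ; β-bij = bijective _≡_ _≡_ _≡_ (τ-bij B) (Bijection.bijective (↔⇒⤖ emap))
    }

  toUndirected : DirBranchDecomposition D → BranchDecomposition (u H)
  toUndirected B = record
    { T = T B
    ; τ = Inverse.from emap ∘ β B
    ; τ-bij = bijective _≡_ _≡_ _≡_ (β-bij B) (Bijection.bijective (↔⇒⤖ (↔-sym emap)))
    }

  toDirected-width : TerminalsHaveDegreeOne H →
    ∀ B j → HasWidthAtMost (u H) B j → DirHasWidthAtMost D (toDirected B) j
  toDirected-width terminals B j width x y x-y =
    let (i , i≤j , size) = width x y x-y in
    i , i≤j , to (orderSet-hasSize⇔fSet-hasSize terminals (T B) (τ-bij B) (β-bij (toDirected B))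
                    (λ _ → refl) x y i) size

  toUndirected-width : TerminalsHaveDegreeOne H →
    ∀ B j → DirHasWidthAtMost D B j → HasWidthAtMost (u H) (toUndirected B) j
  toUndirected-width terminals B j width x y x-y =
    let (i , i≤j , size) = width x y x-y in
    i , i≤j , from (orderSet-hasSize⇔fSet-hasSize terminals (T B) (τ-bij (toUndirected B)) (β-bij B)
                      (λ l → sym (Inverse.strictlyInverseˡ emap (β B l))) x y i) size

IsLeastWidth : {A : Set} → (A → ℕ → Set) → ℕ → Set
IsLeastWidth {A} W k = Σ A (λ a → W a k) × (∀ a j → W a j → k ≤ j)

isLeastWidth-transfer : ∀ {A B : Set} {V : A → ℕ → Set} {W : B → ℕ → Set}
  (f : A → B) (g : B → A) → (∀ a j → V a j → W (f a) j) → (∀ b j → W b j → V (g b) j) →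
  ∀ k → IsLeastWidth V k ⇔ IsLeastWidth W k
isLeastWidth-transfer f g f-pres g-pres k = mk⇔
  (λ ((a , Vak) , least) → (f a , f-pres a k Vak) , λ b j Wbj → least (g b) j (g-pres b j Wbj))
  (λ ((b , Wbk) , least) → (g b , g-pres b k Wbk) , λ a j Vaj → least (f a) j (f-pres a j Vaj))

mainTheorem18 : (H D : Digraph) → IsSourceSinkSplit H D →
    ∀ (k : ℕ) → IsBranchWidth (u H) k ⇔ IsDirBranchWidth D k
mainTheorem18 H D (sources , sinks , obtained) =
  isLeastWidth-transfer (toDirected σ) (toUndirected σ)
    (toDirected-width σ terminals) (toUndirected-width σ terminals)
  where
  σ : SourceSinkMerge H D
  σ = obtainedBySSI⇒merge obtained
  terminals : TerminalsHaveDegreeOne H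
  terminals = sources , sinks
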